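{- For any integer $\ell\ge 1$ and any path $P$, $\bar{\chi}_\ell(K_3\boxtimes P)\le 3(\ell+1)$.
   Context: $K_3$ is the complete graph on 3 vertices. $\bar{\chi}_\ell(G)$ is the minimum number of colours in a colouring of $G$ such that the endpoints of every non-trivial path of length at most $\ell$ receive distinct colours. The strong product $G_1\boxtimes G_2$ has vertex set $V(G_1)\times V(G_2)$, with $(v_1,v_2)(w_1,w_2)$ an edge iff ($v_1=w_1$ and $v_2w_2\in E(G_2)$) or ($v_2=w_2$ and $v_1w_1\in E(G_1)$) or ($v_1w_1\in E(G_1)$ and $v_2w_2\in E(G_2)$). -}

module Defs where

open import Level using (0ℓ)
open import Data.Nat using (ℕ; zero; suc; _+_; _*_; _≤_)
open import Data.Fin using (Fin; toℕ; fromℕ; inject₁) renaming (zero to fzero; suc to fsuc)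
open import Data.Product using (Σ; _×_; _,_; proj₁; proj₂)
open import Data.Sum using (_⊎_)
open import Relation.Binary.PropositionalEquality using (_≡_; _≢_)
open import Function.Definitions using (Injective)

record Graph : Set₁ where
  field
    V   : Set
    Adj : V → V → Set
open Graph public

K : ℕ → Graph
K n = record { V = Fin n ; Adj = λ i j → i ≢ j }

PathGraph : ℕ → Graph
PathGraph n = record
  { V = Fin n
  ; Adj = λ i j → (suc (toℕ i) ≡ toℕ j) ⊎ (suc (toℕ j) ≡ toℕ i) }

_⊠_ : Graph → Graph → Graph
G₁ ⊠ G₂ = record
  { V = V G₁ × V G₂
  ; Adj = λ v w →
      ((proj₁ v ≡ proj₁ w) × Adj G₂ (proj₂ v) (proj₂ w))
      ⊎ ((proj₂ v ≡ proj₂ w) × Adj G₁ (proj₁ v) (proj₁ w))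
      ⊎ (Adj G₁ (proj₁ v) (proj₁ w) × Adj G₂ (proj₂ v) (proj₂ w)) }

record GPath (G : Graph) (k : ℕ) : Set where
  field
    vert     : Fin (suc k) → V G
    distinct : Injective _≡_ _≡_ vert
    adjacent : (i : Fin k) → Adj G (vert (inject₁ i)) (vert (fsuc i))
open GPath public

start : {G : Graph} {k : ℕ} → GPath G k → V G
start p = vert p fzero

end : {G : Graph} {k : ℕ} → GPath G k → V G
end {k = k} p = vert p (fromℕ k)

IsBarColouring : (G : Graph) (ℓ m : ℕ) → (V G → Fin m) → Set
IsBarColouring G ℓ m c =
  (k : ℕ) → 1 ≤ k → k ≤ ℓ → (p : GPath G k) → c (start p) ≢ c (end p)

BarChromatic≤ : (G : Graph) (ℓ m : ℕ) → Set
BarChromatic≤ G ℓ m = Σ (V G → Fin m) (IsBarColouring G ℓ m)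

module Submission where

-- Colour the vertex (a , x) of G ⊠ Pₙ by the pair (κ a , x mod (ℓ + 1)), where
-- κ numbers the m vertices of G injectively; this uses m (ℓ + 1) colours.
-- Along any edge of G ⊠ Pₙ the path coordinate x changes by at most one, so
-- the endpoints of a path with k ≤ ℓ edges have path coordinates at distance
-- at most ℓ < ℓ + 1.  If such endpoints received the same colour, their first
-- coordinates agree (κ is injective) and their path coordinates are congruent
-- modulo ℓ + 1 while being closer than ℓ + 1, hence equal; so the endpoints
-- coincide, contradicting that a path of length k ≥ 1 has distinct vertices.

open import Defs
open import Data.Nat using (ℕ; zero; suc; _+_; _*_; _≤_; _<_; ∣_-_∣; NonZero; z≤n; s≤s)
open import Data.Nat.Properties
  using (≤-trans; ≤-reflexive; +-comm; +-mono-≤; n≤1+n; m+n∸n≡m;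
         m≡n⇒∣m-n∣≡0; ∣m-n∣≡0⇒m≡n; ∣n-n∣≡0; m≤n⇒∣m-n∣≡n∸m; ∣-∣-comm;
         ∣-∣-triangle; ∣m+n-m+o∣≡∣n-o∣; *-distribʳ-∣-∣)
open import Data.Nat.DivMod using (_%_; _/_; m%n<n; m≡m%n+[m/n]*n; m<n⇒m%n≡m)
open import Data.Nat.Divisibility using (_∣_; divides; n∣m⇒m%n≡0)
open import Data.Fin using (Fin; toℕ; fromℕ; fromℕ<; inject₁; combine)
  renaming (zero to fzero; suc to fsuc)
open import Data.Fin.Properties using (toℕ-injective; toℕ-fromℕ<; combine-injective; 0≢1+n)
open import Data.Product using (_,_; proj₂)
open import Data.Sum using (inj₁; inj₂)
open import Function.Definitions using (Injective)
open import Relation.Binary.PropositionalEquality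
  using (_≡_; sym; trans; cong; cong₂; subst; module ≡-Reasoning)

congruent⇒difference-divisible : ∀ L .{{_ : NonZero L}} i j → i % L ≡ j % L → L ∣ ∣ i - j ∣
congruent⇒difference-divisible L i j same = divides ∣ i / L - j / L ∣ (begin
  ∣ i - j ∣                                    ≡⟨ cong₂ ∣_-_∣ (m≡m%n+[m/n]*n i L) j≡ ⟩
  ∣ i % L + (i / L) * L - i % L + (j / L) * L ∣ ≡⟨ ∣m+n-m+o∣≡∣n-o∣ (i % L) _ _ ⟩
  ∣ (i / L) * L - (j / L) * L ∣                ≡⟨ *-distribʳ-∣-∣ L (i / L) (j / L) ⟨
  ∣ i / L - j / L ∣ * L                        ∎)
  where
  open ≡-Reasoning
  j≡ : j ≡ i % L + (j / L) * L
  j≡ = trans (m≡m%n+[m/n]*n j L) (cong (_+ (j / L) * L) (sym same))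

multiple-below⇒zero : ∀ L .{{_ : NonZero L}} d → L ∣ d → d < L → d ≡ 0
multiple-below⇒zero L d L∣d d<L = trans (sym (m<n⇒m%n≡m d<L)) (n∣m⇒m%n≡0 d L L∣d)

congruent-close⇒equal : ∀ L .{{_ : NonZero L}} i j → ∣ i - j ∣ < L → i % L ≡ j % L → i ≡ j
congruent-close⇒equal L i j close same =
  ∣m-n∣≡0⇒m≡n (multiple-below⇒zero L ∣ i - j ∣ (congruent⇒difference-divisible L i j same) close)

unit-steps⇒displacement≤length :
  ∀ k (h : Fin (suc k) → ℕ) →
  (∀ (i : Fin k) → ∣ h (inject₁ i) - h (fsuc i) ∣ ≤ 1) →
  ∣ h fzero - h (fromℕ k) ∣ ≤ k
unit-steps⇒displacement≤length zero h _ = ≤-reflexive (∣n-n∣≡0 (h fzero))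
unit-steps⇒displacement≤length (suc k) h step = begin
  ∣ h fzero - h (fromℕ (suc k)) ∣                   ≤⟨ ∣-∣-triangle (h fzero) (h middle) (h (fromℕ (suc k))) ⟩
  ∣ h fzero - h middle ∣ + ∣ h middle - h (fromℕ (suc k)) ∣
      ≤⟨ +-mono-≤ (unit-steps⇒displacement≤length k (λ i → h (inject₁ i)) (λ i → step (inject₁ i)))
                  (step (fromℕ k)) ⟩
  k + 1                                               ≡⟨ +-comm k 1 ⟩
  suc k                                               ∎
  where
  open Data.Nat.Properties.≤-Reasoning
  middle : Fin (suc (suc k))
  middle = inject₁ (fromℕ k)

pathGraph-adjacent⇒close : ∀ {n} {x y : Fin n} → Adj (PathGraph n) x y → ∣ toℕ x - toℕ y ∣ ≤ 1
pathGraph-adjacent⇒close {x = x} (inj₁ x+1≡y) =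
  subst (λ b → ∣ toℕ x - b ∣ ≤ 1) x+1≡y (successor-close (toℕ x))
  where
  successor-close : ∀ a → ∣ a - suc a ∣ ≤ 1
  successor-close a = ≤-reflexive (trans (m≤n⇒∣m-n∣≡n∸m (n≤1+n a)) (m+n∸n≡m 1 a))
pathGraph-adjacent⇒close {x = x} {y} (inj₂ y+1≡x) =
  subst (_≤ 1) (∣-∣-comm (toℕ y) (toℕ x)) (pathGraph-adjacent⇒close (inj₁ y+1≡x))

strongProduct-adjacent⇒close :
  ∀ (G : Graph) {n} (v w : V (G ⊠ PathGraph n)) → Adj (G ⊠ PathGraph n) v w →
  ∣ toℕ (proj₂ v) - toℕ (proj₂ w) ∣ ≤ 1
strongProduct-adjacent⇒close G v w (inj₁ (_ , xy)) = pathGraph-adjacent⇒close xy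
strongProduct-adjacent⇒close G v w (inj₂ (inj₁ (x≡y , _))) =
  ≤-trans (≤-reflexive (m≡n⇒∣m-n∣≡0 (cong toℕ x≡y))) z≤n
strongProduct-adjacent⇒close G v w (inj₂ (inj₂ (_ , xy))) = pathGraph-adjacent⇒close xy

path-coordinate-displacement :
  ∀ (G : Graph) {n k} (p : GPath (G ⊠ PathGraph n) k) →
  ∣ toℕ (proj₂ (start p)) - toℕ (proj₂ (end p)) ∣ ≤ k
path-coordinate-displacement G {k = k} p =
  unit-steps⇒displacement≤length k (λ i → toℕ (proj₂ (vert p i)))
    (λ i → strongProduct-adjacent⇒close G (vert p (inject₁ i)) (vert p (fsuc i)) (adjacent p i))

stripColouring : ∀ (G : Graph) {m n} (κ : V G → Fin m) (L : ℕ) .{{_ : NonZero L}} →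
                 V (G ⊠ PathGraph n) → Fin (m * L)
stripColouring G κ L (a , x) = combine (κ a) (fromℕ< (m%n<n (toℕ x) L))

sameStripColour⇒equal :
  ∀ (G : Graph) {m n} (κ : V G → Fin m) → Injective _≡_ _≡_ κ →
  ∀ L .{{_ : NonZero L}} (v w : V (G ⊠ PathGraph n)) →
  ∣ toℕ (proj₂ v) - toℕ (proj₂ w) ∣ < L →
  stripColouring G κ L v ≡ stripColouring G κ L w → v ≡ w
sameStripColour⇒equal G κ κ-injective L (a , x) (b , y) close same
  with combine-injective (κ a) _ (κ b) _ same
... | κa≡κb , residues≡ = cong₂ _,_ (κ-injective κa≡κb)
        (toℕ-injective (congruent-close⇒equal L (toℕ x) (toℕ y) close x%L≡y%L))
  where
  x%L≡y%L : toℕ x % L ≡ toℕ y % L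
  x%L≡y%L = trans (sym (toℕ-fromℕ< (m%n<n (toℕ x) L)))
              (trans (cong toℕ residues≡) (toℕ-fromℕ< (m%n<n (toℕ y) L)))

strongProduct-path-bound :
  ∀ (G : Graph) {m} (κ : V G → Fin m) → Injective _≡_ _≡_ κ →
  ∀ ℓ n → BarChromatic≤ (G ⊠ PathGraph n) ℓ (m * suc ℓ)
strongProduct-path-bound G κ κ-injective ℓ n = stripColouring G κ (suc ℓ) , endpoints-differ
  where
  endpoints-differ : IsBarColouring (G ⊠ PathGraph n) ℓ _ (stripColouring G κ (suc ℓ))
  endpoints-differ zero () _ _ _
  endpoints-differ (suc k) _ k+1≤ℓ p same = 0≢1+n (distinct p start≡end)
    where
    start≡end : start p ≡ end p
    start≡end = sameStripColour⇒equal G κ κ-injective (suc ℓ) (start p) (end p)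
                  (s≤s (≤-trans (path-coordinate-displacement G p) k+1≤ℓ)) same

lemma17 : (ℓ : ℕ) → 1 ≤ ℓ → (n : ℕ) → BarChromatic≤ (K 3 ⊠ PathGraph n) ℓ (3 * (ℓ + 1))
lemma17 ℓ _ n =
  subst (BarChromatic≤ (K 3 ⊠ PathGraph n) ℓ) (cong (3 *_) (+-comm 1 ℓ))
    (strongProduct-path-bound (K 3) (λ a → a) (λ {a} {b} a≡b → a≡b) ℓ n)
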